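{- Let $\pi\in\mathfrak{S}_n$ be an indecomposable permutation with exactly one descent, $G=G_\pi$, $s\in[n]$, and $T$ a spanning tree of $G$ rooted at $s$. Then $\mu_i(T)=0$ for all $i\in[n]$.
   Context: $G_\pi$: permutation graph on $[n]$, $a<b$ adjacent iff $b$ appears before $a$ in $\pi$. For $T$ rooted at $s$, $h(i)$ is the distance from $i$ to $s$ in $T$, $T^{(k)}=\{i:h(i)=k\}$, $N_G(i)$ the set of neighbours of $i$ in $G$, and $\mu_i(T)=|N_G(i)\cap T^{(h(i))}|$. -}

module Defs where

open import Data.Nat using (ℕ; zero; suc; _≤_; _<_)
open import Data.Fin using (Fin; toℕ; fromℕ<; fromℕ; inject₁) renaming (zero to fzero; suc to fsuc)
open import Data.Fin.Permutation using (Permutation′; _⟨$⟩ʳ_; _⟨$⟩ˡ_)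
open import Data.Product using (Σ; ∃; _×_; _,_)
open import Data.Sum using (_⊎_)
open import Relation.Nullary using (¬_)
open import Relation.Binary.PropositionalEquality using (_≡_)
open import Function.Definitions using (Injective)

-- Vertices [n] are represented by Fin n (value i+1 ↦ i : Fin n; order preserved).
-- One-line notation: π(i) = π ⟨$⟩ʳ i ; position of value a in π is π ⟨$⟩ˡ a.

Descent : ∀ {n} → Permutation′ n → Fin n → Set
Descent {n} π i = Σ (suc (toℕ i) < n) λ p → π ⟨$⟩ʳ fromℕ< p Data.Fin.< π ⟨$⟩ʳ i

ExactlyOneDescent : ∀ {n} → Permutation′ n → Set
ExactlyOneDescent {n} π =
  Σ (Fin n) λ d → Descent π d × (∀ j → Descent π j → j ≡ d)

Indecomposable : ∀ {n} → Permutation′ n → Set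
Indecomposable {n} π =
  ∀ k → 1 ≤ k → k < n → ¬ (∀ (i : Fin n) → toℕ i < k → toℕ (π ⟨$⟩ʳ i) < k)

PermGraph : ∀ {n} → Permutation′ n → Fin n → Fin n → Set
PermGraph π a b =
  (a Data.Fin.< b × π ⟨$⟩ˡ b Data.Fin.< π ⟨$⟩ˡ a)
  ⊎ (b Data.Fin.< a × π ⟨$⟩ˡ a Data.Fin.< π ⟨$⟩ˡ b)

Graph : ℕ → Set₁
Graph n = Fin n → Fin n → Set

data Walk {n} (E : Graph n) : Fin n → Fin n → ℕ → Set where
  nil  : ∀ {u} → Walk E u u 0
  cons : ∀ {u w v k} → E u w → Walk E w v k → Walk E u v (suc k)

Dist : ∀ {n} → Graph n → Fin n → Fin n → ℕ → Set
Dist E u v k = Walk E u v k × (∀ m → Walk E u v m → k ≤ m)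

Cycle : ∀ {n} → Graph n → ℕ → Set
Cycle {n} E m =
  Σ (Fin (suc (suc (suc m))) → Fin n) λ c →
    Injective _≡_ _≡_ c
    × (∀ (i : Fin (suc (suc m))) → E (c (inject₁ i)) (c (fsuc i)))
    × E (c (fromℕ (suc (suc m)))) (c fzero)

Connected : ∀ {n} → Graph n → Set
Connected E = ∀ u v → ∃ λ k → Walk E u v k

Acyclic : ∀ {n} → Graph n → Set
Acyclic E = ∀ m → ¬ Cycle E m

Symmetric : ∀ {n} → Graph n → Set
Symmetric E = ∀ u v → E u v → E v u

SpanningTree : ∀ {n} → Graph n → Graph n → Set
SpanningTree G T =
  Symmetric T × (∀ u v → T u v → G u v) × Connected T × Acyclic T

Height : ∀ {n} → Graph n → Fin n → Fin n → ℕ → Set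
Height T s i k = Dist T i s k

-- μ_i(T) = 0 : N_G(i) ∩ T^(h(i)) is empty
MuZero : ∀ {n} → Graph n → Graph n → Fin n → Fin n → Set
MuZero G T s i =
  ∀ j k → G i j → Height T s i k → ¬ Height T s j k

-- A permutation with a single descent at position d is increasing on the positions ≤ d and on
-- the positions > d. So if a < b are adjacent in G_π, that is b precedes a, then the positions
-- of a and b lie on different sides of d: colouring each value by the side of d its position
-- lies on is a proper 2-colouring of G_π. In a bipartite graph any two walks of the same length
-- into s start at vertices of the same colour, so vertices at equal height in T ⊆ G_π are never
-- adjacent.
module Submission where

open import Defs
open import Data.Bool using (Bool; true; false; not)
open import Data.Bool.Properties using (¬-not)
open import Data.Nat as ℕ using (ℕ; zero; suc; _+_)
import Data.Nat.Properties as ℕ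
open import Data.Fin using (Fin; toℕ; fromℕ<; _≤_; _<_)
open import Data.Fin.Properties using (toℕ-injective; toℕ-fromℕ<; toℕ<n; _≤?_; <-cmp; <-trans; <-asym)
open import Data.Fin.Permutation using (Permutation′; _⟨$⟩ʳ_; _⟨$⟩ˡ_; inverseʳ)
open import Data.Product using (_,_)
open import Data.Sum using (inj₁; inj₂)
open import Data.Empty using (⊥-elim)
open import Function.Base using (_∘_)
open import Function.Bundles using (Injection)
open import Function.Properties.Inverse using (↔⇒↣)
open import Relation.Nullary using (¬_; yes; no)
open import Relation.Binary.Definitions using (tri<; tri≈; tri>)
open import Relation.Binary.PropositionalEquality

module _ {n : ℕ} (E : Graph n) (colour : Fin n → Bool)
         (proper : ∀ {u v} → E u v → colour u ≢ colour v) where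

  equal-length-walks⇒same-colour : ∀ {u w t k} → Walk E u t k → Walk E w t k → colour u ≡ colour w
  equal-length-walks⇒same-colour nil nil = refl
  equal-length-walks⇒same-colour {u} {w} (cons {w = u′} e W) (cons {w = w′} e′ W′) = begin
    colour u        ≡⟨ ¬-not (proper e) ⟩
    not (colour u′) ≡⟨ cong not (equal-length-walks⇒same-colour W W′) ⟩
    not (colour w′) ≡⟨ sym (¬-not (proper e′)) ⟩
    colour w        ∎
    where open ≡-Reasoning

properly-2-coloured⇒MuZero : ∀ {n} (G T : Graph n) (colour : Fin n → Bool) →
  (∀ {u v} → G u v → colour u ≢ colour v) → (∀ u v → T u v → G u v) →
  ∀ s i → MuZero G T s i
properly-2-coloured⇒MuZero G T colour proper T⊆G s i j k i~j (i→s , _) (j→s , _) =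
  proper i~j (equal-length-walks⇒same-colour T colour (λ {u} {v} e → proper (T⊆G u v e)) i→s j→s)

module _ {n m : ℕ} (f : Fin n → Fin m) where

  AscentAt : Fin n → Set
  AscentAt j = (j+1<n : suc (toℕ j) ℕ.< n) → f j < f (fromℕ< j+1<n)

  ascent-into : ∀ {j q} → toℕ q ≡ suc (toℕ j) → AscentAt j → f j < f q
  ascent-into {j} {q} q≡j+1 asc = subst (λ r → f j < f r) j+1≡q (asc j+1<n)
    where
    j+1<n : suc (toℕ j) ℕ.< n
    j+1<n = subst (ℕ._< n) q≡j+1 (toℕ<n q)
    j+1≡q : fromℕ< j+1<n ≡ q
    j+1≡q = toℕ-injective (trans (toℕ-fromℕ< j+1<n) (sym q≡j+1))

  increasing-run-of-length : ∀ k {p q} → toℕ q ≡ suc (k + toℕ p) →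
    (∀ j → p ≤ j → j < q → AscentAt j) → f p < f q
  increasing-run-of-length zero q≡p+1 asc =
    ascent-into q≡p+1 (asc _ ℕ.≤-refl (ℕ.≤-reflexive (sym q≡p+1)))
  increasing-run-of-length (suc k) {p} {q} q≡ asc =
    <-trans (ascent-into (toℕ-fromℕ< p+1<n) (asc p ℕ.≤-refl p<q))
            (increasing-run-of-length k q≡′ (λ j p′≤j → asc j (ℕ.<⇒≤ (subst (ℕ._≤ toℕ j) (toℕ-fromℕ< p+1<n) p′≤j))))
    where
    p<q : p < q
    p<q = subst (toℕ p ℕ.<_) (sym q≡) (ℕ.s≤s (ℕ.m≤n+m (toℕ p) (suc k)))
    p+1<n : suc (toℕ p) ℕ.< n
    p+1<n = ℕ.≤-<-trans p<q (toℕ<n q)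
    q≡′ : toℕ q ≡ suc (k + toℕ (fromℕ< p+1<n))
    q≡′ = trans q≡ (cong suc (trans (sym (ℕ.+-suc k (toℕ p))) (cong (k +_) (sym (toℕ-fromℕ< p+1<n)))))

  increasing-run : ∀ {p q} → p < q → (∀ j → p ≤ j → j < q → AscentAt j) → f p < f q
  increasing-run {p} {q} p<q with ℕ.m≤n⇒∃[o]m+o≡n p<q
  ... | k , p+1+k≡q = increasing-run-of-length k (trans (sym p+1+k≡q) (cong suc (ℕ.+-comm (toℕ p) k)))

sideOf : ∀ {n} → Fin n → Fin n → Bool
sideOf d x with x ≤? d
... | yes _ = true
... | no  _ = false

same-side⇒≢-between : ∀ {n} {d p q j : Fin n} → sideOf d p ≡ sideOf d q → p ≤ j → j < q → j ≢ d
same-side⇒≢-between {d = d} {p} {q} same p≤j j<q j≡d with p ≤? d | q ≤? d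
... | yes _   | yes q≤d = ℕ.<⇒≢ (ℕ.<-≤-trans j<q q≤d) (cong toℕ j≡d)
... | no  p≰d | no  _   = ℕ.<⇒≢ (ℕ.<-≤-trans (ℕ.≰⇒> p≰d) p≤j) (cong toℕ (sym j≡d))
same-side⇒≢-between () _ _ _ | yes _ | no _
same-side⇒≢-between () _ _ _ | no _  | yes _

module _ {n : ℕ} (π : Permutation′ n) where

  ascent-unless-descent : ∀ j → ¬ Descent π j → AscentAt (π ⟨$⟩ʳ_) j
  ascent-unless-descent j ¬desc j+1<n with <-cmp (π ⟨$⟩ʳ j) (π ⟨$⟩ʳ fromℕ< j+1<n)
  ... | tri< lt _ _ = lt
  ... | tri≈ _ eq _ = ⊥-elim (ℕ.1+n≢n (trans (sym (toℕ-fromℕ< j+1<n))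
                                           (cong toℕ (sym (Injection.injective (↔⇒↣ π) eq)))))
  ... | tri> _ _ gt = ⊥-elim (¬desc (j+1<n , gt))

  module _ (d : Fin n) (unique : ∀ j → Descent π j → j ≡ d) where

    inversion⇒sides-differ : ∀ {u v} → u < v → π ⟨$⟩ˡ v < π ⟨$⟩ˡ u →
      sideOf d (π ⟨$⟩ˡ u) ≢ sideOf d (π ⟨$⟩ˡ v)
    inversion⇒sides-differ u<v v-before-u same = <-asym u<v
      (subst₂ _<_ (inverseʳ π) (inverseʳ π)
        (increasing-run (π ⟨$⟩ʳ_) v-before-u
          (λ j v≤j j<u → ascent-unless-descent j (same-side⇒≢-between (sym same) v≤j j<u ∘ unique j))))

    permGraph-properly-coloured : ∀ {u v} → PermGraph π u v →
      sideOf d (π ⟨$⟩ˡ u) ≢ sideOf d (π ⟨$⟩ˡ v)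
    permGraph-properly-coloured (inj₁ (u<v , v-before-u)) = inversion⇒sides-differ u<v v-before-u
    permGraph-properly-coloured (inj₂ (v<u , u-before-v)) same = inversion⇒sides-differ v<u u-before-v (sym same)

proposition5p4 : (n : ℕ) (π : Permutation′ n) → Indecomposable π → ExactlyOneDescent π
    → (s : Fin n) (T : Graph n) → SpanningTree (PermGraph π) T
    → ∀ (i : Fin n) → MuZero (PermGraph π) T s i
proposition5p4 n π _ (d , _ , unique) s T (_ , T⊆G , _ , _) =
  properly-2-coloured⇒MuZero (PermGraph π) T (λ v → sideOf d (π ⟨$⟩ˡ v))
    (permGraph-properly-coloured π d unique) T⊆G s
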